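{- For set compositions $\Phi\models[n]$ and $\Psi\models[m]$, in $NCQSym$ $$\mathbf{Q}_\Phi\mathbf{Q}_\Psi=\sum_{\Gamma\in\Phi\,\widetilde{\sqcup\!\sqcup}\,\Psi}\mathbf{Q}_\Gamma .$$
   Context: A set composition $\Phi\models[n]$ is a sequence $(\Phi_1,\dots,\Phi_\ell)$ of nonempty pairwise disjoint subsets of $[n]$ with union $[n]$; $\ell(\Phi)=\ell$. For $\Phi\models[n]$, $\Psi\models[k]$, $\Phi|\Psi=(\Phi_1,\dots,\Phi_{\ell(\Phi)},\Psi_1+n,\dots,\Psi_{\ell(\Psi)}+n)$. For set compositions $\Phi,\Psi$ of the same set, $\Phi\wedge\Psi$ is the sequence $(\Phi_1\cap\Psi_1,\Phi_1\cap\Psi_2,\dots,\Phi_2\cap\Psi_1,\dots,\Phi_{\ell(\Phi)}\cap\Psi_{\ell(\Psi)})$ (intersections listed with $\Phi$-index major, $\Psi$-index minor), with empty intersections removed. $([n])|([k])$ denotes $(\{1,\dots,n\},\{n+1,\dots,n+k\})$. $NCQSym$ is the $\mathbb{Q}$-algebra with basis $\{\mathbf{M}_\Phi:\Phi\models[n],n\ge0\}$ and product $\mathbf{M}_\Phi\mathbf{M}_\Psi=\sum_{\Gamma\models[n+k],\ (([n])|([k]))\wedge\Gamma=\Phi|\Psi}\mathbf{M}_\Gamma$ for $\Phi\models[n]$, $\Psi\models[k]$. The order $\le_\ast$ on set compositions of $[n]$ is the reflexive–transitive closure of the covering relations $\Phi\lessdot(\Phi_1,\dots,\Phi_{i-1},\Phi_i\cup\Phi_{i+1},\Phi_{i+2},\dots,\Phi_{\ell(\Phi)})$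 for each $1\le i<\ell(\Phi)$ such that every element of $\Phi_i$ is less than every element of $\Phi_{i+1}$. Define $\mathbf{Q}_\Phi=\sum_{\Phi'\ge_\ast\Phi}\mathbf{M}_{\Phi'}$. For $\Phi\models[n]$, $\Psi\models[m]$, $\Phi\,\widetilde{\sqcup\!\sqcup}\,\Psi$ is the set of set compositions of $[n+m]$ obtained as shuffles of the sequence $(\Phi_1,\dots,\Phi_{\ell(\Phi)})$ with the sequence $(\Psi_1+n,\dots,\Psi_{\ell(\Psi)}+n)$ (preserving the internal order of each). -}

module Defs where

open import Data.Nat using (ℕ; zero; suc; _+_)
open import Data.Fin using (Fin; zero; suc; _↑ˡ_; _↑ʳ_; _<_)
open import Data.Fin.Properties using (_<?_) renaming (_≟_ to _≟F_)
open import Data.List using (List; []; _∷_; [_]; _++_; map; concatMap; filter; deduplicate; length; concat; allFin)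
open import Data.List.Relation.Unary.All using (All; all?)
open import Data.List.Relation.Unary.Linked using (Linked)
open import Data.List.Relation.Binary.Permutation.Propositional using (_↭_)
import Data.List.Membership.DecPropositional as DecMem
open import Data.List.Properties using () renaming (≡-dec to ≡-decL)
open import Data.Product using (Σ; _×_; _,_)
open import Data.Product.Properties using () renaming (≡-dec to ≡-decΣ)
open import Data.Nat.Properties using () renaming (_≟_ to _≟ℕ_)
open import Data.Rational using (ℚ; 0ℚ; 1ℚ) renaming (_+_ to _+ℚ_; _*_ to _*ℚ_)
open import Data.Vec.Functional using () renaming (_∷_ to _∷ᶠ_)
open import Relation.Nullary using (¬?; does)
open import Relation.Binary.PropositionalEquality using (_≡_; _≢_)
open import Relation.Binary.Definitions using (DecidableEquality)
open import Data.Bool using (if_then_else_)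

-- Set compositions of [n] = {0,…,n-1} (Fin n).
-- A block (subset) is represented canonically as a strictly increasing
-- list; a set composition as the list of its blocks, in order.

Block : ℕ → Set
Block n = List (Fin n)

SC : ℕ → Set
SC n = List (Block n)

NonEmpty : ∀ {n} → Block n → Set
NonEmpty b = b ≢ []

IsSetComp : (n : ℕ) → SC n → Set
IsSetComp n Φ = All NonEmpty Φ × All (Linked _<_) Φ × (concat Φ ↭ allFin n)

_≟B_ : ∀ {n} → DecidableEquality (Block n)
_≟B_ = ≡-decL _≟F_

_≟SC_ : ∀ {n} → DecidableEquality (SC n)
_≟SC_ = ≡-decL _≟B_

-- Enumeration of all set compositions of [N]:
-- every surjection-onto-an-initial-segment w : [N] → [N] gives the
-- composition ({i | w i = 0}, {i | w i = 1}, …) with empty blocks removed;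
-- we take all functions w and remove duplicates.

allFuns : (N k : ℕ) → List (Fin k → Fin N)
allFuns N zero    = [ (λ ()) ]
allFuns N (suc k) = concatMap (λ j → map (λ f → j ∷ᶠ f) (allFuns N k)) (allFin N)

removeEmpty : ∀ {n} → SC n → SC n
removeEmpty = filter (λ b → ¬? (b ≟B []))

blocksOf : ∀ {N} → (Fin N → Fin N) → SC N
blocksOf {N} w = removeEmpty (map (λ j → filter (λ i → w i ≟F j) (allFin N)) (allFin N))

allSC : (N : ℕ) → List (SC N)
allSC N = deduplicate _≟SC_ (map blocksOf (allFuns N N))

_∣_ : ∀ {n k} → SC n → SC k → SC (n + k)
_∣_ {n} {k} Φ Ψ = map (map (_↑ˡ k)) Φ ++ map (map (n ↑ʳ_)) Ψ

_∩_ : ∀ {n} → Block n → Block n → Block n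
A ∩ B = filter (λ x → DecMem._∈?_ _≟F_ x B) A

_∧_ : ∀ {n} → SC n → SC n → SC n
Φ ∧ Ψ = removeEmpty (concatMap (λ A → map (λ B → A ∩ B) Ψ) Φ)

split : (n k : ℕ) → SC (n + k)
split n k = [ allFin n ] ∣ [ allFin k ]

-- Elements of NCQSym: formal ℚ-linear combinations of basis elements
-- M_Γ, Γ ⊨ [N] for some N, compared by their coefficients.

Key : Set
Key = Σ ℕ SC

_≟K_ : DecidableEquality Key
_≟K_ = ≡-decΣ _≟ℕ_ _≟SC_

NCQSym : Set
NCQSym = List (ℚ × Key)

coeff : NCQSym → Key → ℚ
coeff []            κ = 0ℚ
coeff ((q , κ') ∷ x) κ = (if does (κ' ≟K κ) then q else 0ℚ) +ℚ coeff x κ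

_≈_ : NCQSym → NCQSym → Set
x ≈ y = ∀ κ → coeff x κ ≡ coeff y κ

scale : ℚ → NCQSym → NCQSym
scale a = map (λ { (q , κ) → (a *ℚ q , κ) })

sumN : List NCQSym → NCQSym
sumN = concat

M : ∀ {n} → SC n → NCQSym
M {n} Φ = [ (1ℚ , (n , Φ)) ]

MM : ∀ {n k} → SC n → SC k → NCQSym
MM {n} {k} Φ Ψ =
  sumN (map M (filter (λ Γ → (split n k ∧ Γ) ≟SC (Φ ∣ Ψ)) (allSC (n + k))))

MMkey : Key → Key → NCQSym
MMkey (n , Φ) (k , Ψ) = MM Φ Ψ

_·_ : NCQSym → NCQSym → NCQSym
x · y = concatMap (λ { (a , κ) → concatMap (λ { (b , λ') → scale (a *ℚ b) (MMkey κ λ') }) y }) x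

-- all elements covering Φ: merge Φ_i, Φ_{i+1} when every element of
-- Φ_i is less than every element of Φ_{i+1} (the union, written in
-- increasing order, is Φ_i ++ Φ_{i+1})
allLess : ∀ {n} → Block n → Block n → Set
allLess A B = All (λ a → All (λ b → a < b) B) A

covers : ∀ {n} → SC n → List (SC n)
covers []              = []
covers (A ∷ [])        = []
covers (A ∷ B ∷ rest)  =
  (if does (all? (λ a → all? (λ b → a <? b) B) A) then [ (A ++ B) ∷ rest ] else [])
  ++ map (A ∷_) (covers (B ∷ rest))

reach : ∀ {n} → ℕ → SC n → List (SC n)
reach zero     Φ = [ Φ ]
reach (suc f)  Φ = Φ ∷ concatMap (reach f) (covers Φ)

-- { Φ' | Φ' ≥* Φ }: each covering step decreases the number of blocks,
-- so ℓ(Φ) steps suffice for the reflexive-transitive closure.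
upSet : ∀ {n} → SC n → List (SC n)
upSet Φ = deduplicate _≟SC_ (reach (length Φ) Φ)

Q : ∀ {n} → SC n → NCQSym
Q Φ = sumN (map M (upSet Φ))

shuffles : ∀ {A : Set} → List A → List A → List (List A)
shuffles []       ys       = [ ys ]
shuffles (x ∷ xs) []       = [ x ∷ xs ]
shuffles (x ∷ xs) (y ∷ ys) =
  map (x ∷_) (shuffles xs (y ∷ ys)) ++ map (y ∷_) (shuffles (x ∷ xs) ys)

shuffleSC : ∀ {n m} → SC n → SC m → List (SC (n + m))
shuffleSC {n} {m} Φ Ψ = shuffles (map (map (_↑ˡ m)) Φ) (map (map (n ↑ʳ_)) Ψ)

-- Both sides are sums of basis elements M_Γ with coefficient 1: on the left Γ runs over the
-- set compositions with ([n]|[m]) ∧ Γ = Φ′|Ψ′ for some Φ′ ≥* Φ and Ψ′ ≥* Ψ, on the right over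
-- the Γ ≥* S for some shuffle S of Φ and Ψ + n. Neither list has repetitions, so it suffices
-- that they have the same members. Restriction to [n] (resp. n + [m]) is monotone for ≤* and
-- sends a shuffle back to Φ (resp. Ψ + n), which gives one inclusion. Conversely, merges only
-- join blocks whose elements increase, so every block of Γ is its part in [n] followed by its
-- part in n + [m]; the runs of blocks of Φ and of Ψ + n that merge into these two parts, laid
-- side by side block after block, form a shuffle S ≤* Γ. A shuffle is determined by the
-- concatenation of its blocks, which rules out repetitions on the right.

module Submission where

open import Defs
open import Data.Nat as ℕ using (ℕ; zero; suc; _+_; z<s; s<s)
import Data.Nat.Properties as ℕP
open import Data.Fin as F using (Fin; _<_; toℕ; fromℕ<; _↑ˡ_; _↑ʳ_)
import Data.Fin.Properties as FP
open import Data.List using (List; []; _∷_; [_]; _++_; map; concatMap; filter; length; concat; allFin; tabulate)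
open import Data.List.Properties
  using (++-assoc; ++-identityʳ; ++-cancelˡ; concat-++; ∷-injectiveˡ; ∷-injectiveʳ; map-++; map-cong; map-cong-local; map-injective;
         map-tabulate; length-++; length-tabulate; concat-map; filter-++; filter-accept; filter-reject; filter-all; filter-none)
open import Data.List.Relation.Unary.All as All using (All; []; _∷_; all?)
import Data.List.Relation.Unary.All.Properties as AllP
open import Data.List.Relation.Unary.Any using (Any; here; there)
open import Data.List.Relation.Unary.AllPairs as AllPairs using (AllPairs; []; _∷_)
import Data.List.Relation.Unary.AllPairs.Properties as AllPairsP
open import Data.List.Relation.Unary.Linked using (Linked)
import Data.List.Relation.Unary.Linked.Properties as LinkedP
open import Data.List.Relation.Unary.Unique.Propositional using (Unique)
import Data.List.Relation.Unary.Unique.Propositional.Properties as UniqueP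
import Data.List.Relation.Unary.Unique.DecPropositional.Properties as UniqueDecP
open import Data.List.Relation.Binary.Permutation.Propositional as ↭
  using (_↭_; ↭-sym; ↭-refl; ↭-trans; ↭-reflexive; ↭⇒↭ₛ)
import Data.List.Relation.Binary.Permutation.Propositional.Properties as ↭P
import Data.List.Relation.Binary.Permutation.Setoid.Properties as ↭ₛP
open import Data.List.Relation.Binary.Subset.Propositional using (_⊆_)
import Data.List.Relation.Binary.Subset.Propositional.Properties as ⊆P
open import Data.List.Membership.Propositional using (_∈_; _∉_; find; lose)
open import Data.List.Membership.Propositional.Properties
import Data.List.Membership.DecPropositional as DecMembership
open import Data.List.Relation.Ternary.Interleaving.Propositional as Interleaving using (Interleaving; []; consˡ; consʳ)
import Data.List.Relation.Ternary.Interleaving.Propositional.Properties as InterleavingP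
open import Data.Product using (_×_; _,_; proj₁; proj₂; ∃; ∃₂)
open import Data.Sum using (_⊎_; inj₁; inj₂)
open import Data.Empty using (⊥; ⊥-elim)
open import Data.Vec.Functional using () renaming (_∷_ to _∷ᶠ_)
open import Data.Rational using (0ℚ; 1ℚ) renaming (_+_ to _+ℚ_; _*_ to _*ℚ_)
import Data.Rational.Properties as ℚP
open import Relation.Nullary using (yes; no; ¬_; ¬?)
open import Relation.Unary using (Pred; Decidable)
open import Relation.Binary.Definitions using (Irreflexive; Asymmetric)
open import Relation.Binary.PropositionalEquality hiding ([_])
open import Function using (_∘_)
open import Level using (0ℓ)

module _ {A B : Set} (f : A → List B) where

  ∈-concatMap⁺′ : ∀ {xs x y} → x ∈ xs → y ∈ f x → y ∈ concatMap f xs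
  ∈-concatMap⁺′ x∈ y∈ = ∈-concatMap⁺ f (lose x∈ y∈)

  ∈-concatMap⁻′ : ∀ xs {y} → y ∈ concatMap f xs → ∃ λ x → x ∈ xs × y ∈ f x
  ∈-concatMap⁻′ xs y∈ = find (∈-concatMap⁻ f {xs = xs} y∈)

  Unique-concatMap⁺ : ∀ {xs} → Unique xs → (∀ {x} → x ∈ xs → Unique (f x)) →
                      (∀ {x x′ y} → x ∈ xs → x′ ∈ xs → y ∈ f x → y ∈ f x′ → x ≡ x′) → Unique (concatMap f xs)
  Unique-concatMap⁺ {[]} [] _ _ = []
  Unique-concatMap⁺ {x ∷ xs} (x∉xs ∷ xs!) f! separated =
    UniqueP.++⁺ (f! (here refl))
                (Unique-concatMap⁺ xs! (f! ∘ there) (λ p q → separated (there p) (there q)))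
                (λ (y∈fx , y∈rest) → disjoint y∈fx y∈rest)
    where
    disjoint : ∀ {y} → y ∈ f x → y ∈ concatMap f xs → ⊥
    disjoint y∈fx y∈rest with ∈-concatMap⁻′ xs y∈rest
    ... | x′ , x′∈ , y∈fx′ = All.lookup x∉xs x′∈ (separated (here refl) (there x′∈) y∈fx y∈fx′)

module _ {A : Set} where

  Unique-resp-↭ : ∀ {xs ys : List A} → xs ↭ ys → Unique xs → Unique ys
  Unique-resp-↭ p = ↭ₛP.Unique-resp-↭ (setoid A) (↭⇒↭ₛ p)

  concat⁺-↭ : ∀ {xss yss : List (List A)} → xss ↭ yss → concat xss ↭ concat yss
  concat⁺-↭ ↭.refl             = ↭-refl
  concat⁺-↭ (↭.prep xs p)      = ↭P.++⁺ˡ xs (concat⁺-↭ p)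
  concat⁺-↭ (↭.swap xs ys p)   = ↭-trans (↭P.shifts xs ys) (↭P.++⁺ˡ ys (↭P.++⁺ˡ xs (concat⁺-↭ p)))
  concat⁺-↭ (↭.trans p q)      = ↭-trans (concat⁺-↭ p) (concat⁺-↭ q)

  ++-cancel-separated : ∀ {P : A → Set} {xs ys xs′ ys′} → All P xs → All (¬_ ∘ P) ys → All P xs′ → All (¬_ ∘ P) ys′ →
                        xs ++ ys ≡ xs′ ++ ys′ → xs ≡ xs′ × ys ≡ ys′
  ++-cancel-separated [] _ [] _ eq = refl , eq
  ++-cancel-separated [] (¬py ∷ _) (px′ ∷ _) _ eq = ⊥-elim (¬py (subst _ (sym (∷-injectiveˡ eq)) px′))
  ++-cancel-separated [] [] (_ ∷ _) _ ()
  ++-cancel-separated (px ∷ _) _ [] (¬py′ ∷ _) eq = ⊥-elim (¬py′ (subst _ (∷-injectiveˡ eq) px))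
  ++-cancel-separated (_ ∷ _) _ [] [] ()
  ++-cancel-separated (_ ∷ pxs) ¬ys (_ ∷ pxs′) ¬ys′ eq with ∷-injectiveˡ eq
  ... | refl = let xs≡ , ys≡ = ++-cancel-separated pxs ¬ys pxs′ ¬ys′ (∷-injectiveʳ eq) in cong (_ ∷_) xs≡ , ys≡

module _ {A : Set} {_≺_ : A → A → Set} (irrefl : Irreflexive _≡_ _≺_) (asym : Asymmetric _≺_) where

  sorted-extensional : ∀ {xs ys} → AllPairs _≺_ xs → AllPairs _≺_ ys → xs ⊆ ys → ys ⊆ xs → xs ≡ ys
  sorted-extensional {[]} {[]} _ _ _ _ = refl
  sorted-extensional {[]} {y ∷ _} _ _ _ ys⊆ with ys⊆ (here refl)
  ... | ()
  sorted-extensional {x ∷ _} {[]} _ _ xs⊆ _ with xs⊆ (here refl)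
  ... | ()
  sorted-extensional {x ∷ xs} {y ∷ ys} (x≺xs ∷ sxs) (y≺ys ∷ sys) xs⊆ ys⊆ =
    cong₂ _∷_ x≡y (sorted-extensional sxs sys tail⊆ tail⊇)
    where
    x≡y : x ≡ y
    x≡y with xs⊆ (here refl) | ys⊆ (here refl)
    ... | here x≡y | _        = x≡y
    ... | there _  | here y≡x = sym y≡x
    ... | there x∈ | there y∈ = ⊥-elim (asym (All.lookup y≺ys x∈) (All.lookup x≺xs y∈))
    tail⊆ : xs ⊆ ys
    tail⊆ z∈ with xs⊆ (there z∈)
    ... | here refl = ⊥-elim (irrefl x≡y (All.lookup x≺xs z∈))
    ... | there z∈′ = z∈′
    tail⊇ : ys ⊆ xs
    tail⊇ z∈ with ys⊆ (there z∈)
    ... | here refl = ⊥-elim (irrefl (sym x≡y) (All.lookup y≺ys z∈))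
    ... | there z∈′ = z∈′

-- Shuffles

module _ {A : Set} where

  Interleaving-[]ʳ : ∀ {xs zs : List A} → Interleaving xs [] zs → zs ≡ xs
  Interleaving-[]ʳ []         = refl
  Interleaving-[]ʳ (consˡ sp) = cong (_ ∷_) (Interleaving-[]ʳ sp)

  ∈shuffles⇒Interleaving : ∀ (xs ys : List A) {zs} → zs ∈ shuffles xs ys → Interleaving xs ys zs
  ∈shuffles⇒Interleaving []       ys       (here refl) = InterleavingP.++-linear [] ys
  ∈shuffles⇒Interleaving (x ∷ xs) []       (here refl) =
    subst (Interleaving _ []) (++-identityʳ (x ∷ xs)) (InterleavingP.++-linear (x ∷ xs) [])
  ∈shuffles⇒Interleaving (x ∷ xs) (y ∷ ys) m with ∈-++⁻ (map (x ∷_) (shuffles xs (y ∷ ys))) m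
  ... | inj₁ m′ with ∈-map⁻ (x ∷_) m′
  ...   | _ , m″ , refl = consˡ (∈shuffles⇒Interleaving xs (y ∷ ys) m″)
  ∈shuffles⇒Interleaving (x ∷ xs) (y ∷ ys) m | inj₂ m′ with ∈-map⁻ (y ∷_) m′
  ...   | _ , m″ , refl = consʳ (∈shuffles⇒Interleaving (x ∷ xs) ys m″)

  Interleaving⇒∈shuffles : ∀ {xs ys zs : List A} → Interleaving xs ys zs → zs ∈ shuffles xs ys
  Interleaving⇒∈shuffles [] = here refl
  Interleaving⇒∈shuffles {x ∷ xs} {[]} sp with Interleaving-[]ʳ sp
  ... | refl = here refl
  Interleaving⇒∈shuffles {x ∷ xs} {y ∷ ys} (consˡ sp) = ∈-++⁺ˡ (∈-map⁺ (x ∷_) (Interleaving⇒∈shuffles sp))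
  Interleaving⇒∈shuffles {[]} {y ∷ ys} (consʳ sp) with Interleaving⇒∈shuffles sp
  ... | here refl = here refl
  Interleaving⇒∈shuffles {x ∷ xs} {y ∷ ys} (consʳ sp) =
    ∈-++⁺ʳ (map (x ∷_) (shuffles xs (y ∷ ys))) (∈-map⁺ (y ∷_) (Interleaving⇒∈shuffles sp))

  Unique-shuffles : ∀ (xs ys : List A) → (∀ {x y} → x ∈ xs → y ∈ ys → x ≢ y) → Unique (shuffles xs ys)
  Unique-shuffles []       _        _  = [] ∷ []
  Unique-shuffles (_ ∷ _)  []       _  = [] ∷ []
  Unique-shuffles (x ∷ xs) (y ∷ ys) xs≢ys =
    UniqueP.++⁺ (UniqueP.map⁺ ∷-injectiveʳ (Unique-shuffles xs (y ∷ ys) (xs≢ys ∘ there)))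
                (UniqueP.map⁺ ∷-injectiveʳ (Unique-shuffles (x ∷ xs) ys (λ p q → xs≢ys p (there q))))
                (λ (m₁ , m₂) → heads-differ m₁ m₂)
    where
    heads-differ : ∀ {zs} → zs ∈ map (x ∷_) (shuffles xs (y ∷ ys)) → zs ∈ map (y ∷_) (shuffles (x ∷ xs) ys) → ⊥
    heads-differ m₁ m₂ with ∈-map⁻ (x ∷_) m₁ | ∈-map⁻ (y ∷_) m₂
    ... | _ , _ , refl | _ , _ , x∷≡y∷ = xs≢ys (here refl) (here refl) (∷-injectiveˡ x∷≡y∷)

  Interleaving-All : ∀ {Q : A → Set} {xs ys zs} → All Q xs → All Q ys → Interleaving xs ys zs → All Q zs
  Interleaving-All []        []        []         = []
  Interleaving-All (qx ∷ qxs) qys      (consˡ sp) = qx ∷ Interleaving-All qxs qys sp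
  Interleaving-All qxs       (qy ∷ qys) (consʳ sp) = qy ∷ Interleaving-All qxs qys sp

  ++-heads-differ : ∀ {P : A → Set} {xs ys us vs} → xs ≢ [] → ys ≢ [] → All P xs → All (¬_ ∘ P) ys →
                    xs ++ us ≢ ys ++ vs
  ++-heads-differ {xs = []} xs≢[] _ _ _ _ = xs≢[] refl
  ++-heads-differ {ys = []} _ ys≢[] _ _ _ = ys≢[] refl
  ++-heads-differ {xs = _ ∷ _} {ys = _ ∷ _} _ _ (px ∷ _) (¬py ∷ _) eq = ¬py (subst _ (∷-injectiveˡ eq) px)

  concat-Interleaving-injective :
    ∀ {P : A → Set} {xss yss zss₁ zss₂} →
    All (λ xs → xs ≢ [] × All P xs) xss → All (λ ys → ys ≢ [] × All (¬_ ∘ P) ys) yss →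
    Interleaving xss yss zss₁ → Interleaving xss yss zss₂ → concat zss₁ ≡ concat zss₂ → zss₁ ≡ zss₂
  concat-Interleaving-injective _ _ [] [] _ = refl
  concat-Interleaving-injective {xss = xs ∷ _} (_ ∷ pxss) pyss (consˡ sp₁) (consˡ sp₂) eq =
    cong (xs ∷_) (concat-Interleaving-injective pxss pyss sp₁ sp₂ (++-cancelˡ xs _ _ eq))
  concat-Interleaving-injective {yss = ys ∷ _} pxss (_ ∷ pyss) (consʳ sp₁) (consʳ sp₂) eq =
    cong (ys ∷_) (concat-Interleaving-injective pxss pyss sp₁ sp₂ (++-cancelˡ ys _ _ eq))
  concat-Interleaving-injective ((xs≢[] , pxs) ∷ _) ((ys≢[] , ¬pys) ∷ _) (consˡ _) (consʳ _) eq =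
    ⊥-elim (++-heads-differ xs≢[] ys≢[] pxs ¬pys eq)
  concat-Interleaving-injective ((xs≢[] , pxs) ∷ _) ((ys≢[] , ¬pys) ∷ _) (consʳ _) (consˡ _) eq =
    ⊥-elim (++-heads-differ xs≢[] ys≢[] pxs ¬pys (sym eq))

-- The order ≤* as an inductive relation

module _ {N : ℕ} where

  nonEmpty-All⇒Any : ∀ {Q : Fin N → Set} {B} → NonEmpty B → All Q B → Any Q B
  nonEmpty-All⇒Any {B = []}    B≢[] _       = ⊥-elim (B≢[] refl)
  nonEmpty-All⇒Any {B = _ ∷ _} _    (q ∷ _) = here q

  nonEmpty-map : ∀ {K} {f : Fin N → Fin K} {B} → NonEmpty B → NonEmpty (map f B)
  nonEmpty-map {B = []}    B≢[] = ⊥-elim (B≢[] refl)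
  nonEmpty-map {B = _ ∷ _} _    = λ ()

  infix 4 _≤*_

  -- Γ ∈ upSet Σ, in a normal form that performs the merges forming each block of Γ left to right.
  data _≤*_ : SC N → SC N → Set where
    []    : [] ≤* []
    keep  : ∀ {A Σ Γ} → Σ ≤* Γ → A ∷ Σ ≤* A ∷ Γ
    merge : ∀ {A B Σ Γ} → allLess A B → (A ++ B) ∷ Σ ≤* Γ → A ∷ B ∷ Σ ≤* Γ

  ≤*-refl : ∀ Σ → Σ ≤* Σ
  ≤*-refl []      = []
  ≤*-refl (A ∷ Σ) = keep (≤*-refl Σ)

  allLess-++ʳ⁻ : ∀ {A : Block N} B {D} → allLess A (B ++ D) → allLess A B × allLess A D
  allLess-++ʳ⁻ B A<BD = All.map (AllP.++⁻ˡ B) A<BD , All.map (AllP.++⁻ʳ B) A<BD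

  infix 4 _⋖_

  data _⋖_ : SC N → SC N → Set where
    here  : ∀ {A B Σ} → allLess A B → A ∷ B ∷ Σ ⋖ (A ++ B) ∷ Σ
    there : ∀ {A Σ Σ′} → Σ ⋖ Σ′ → A ∷ Σ ⋖ A ∷ Σ′

  ⋖⇒∈covers : ∀ {Σ Σ′} → Σ ⋖ Σ′ → Σ′ ∈ covers Σ
  ⋖⇒∈covers (here {A} {B} A<B) with all? (λ a → all? (λ b → a FP.<? b) B) A
  ... | yes _   = here refl
  ... | no A≮B  = ⊥-elim (A≮B A<B)
  ⋖⇒∈covers (there {A} {B ∷ Σ} s) = ∈-++⁺ʳ _ (∈-map⁺ (A ∷_) (⋖⇒∈covers s))

  ∈covers⇒⋖ : ∀ {Σ Σ′} → Σ′ ∈ covers Σ → Σ ⋖ Σ′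
  ∈map∷covers⇒⋖ : ∀ {A Σ Σ′} → Σ′ ∈ map (A ∷_) (covers Σ) → A ∷ Σ ⋖ Σ′

  ∈covers⇒⋖ {A ∷ B ∷ Σ} m with all? (λ a → all? (λ b → a FP.<? b) B) A | m
  ... | yes A<B | here refl = here A<B
  ... | yes _   | there m′  = ∈map∷covers⇒⋖ m′
  ... | no _    | m′        = ∈map∷covers⇒⋖ m′

  ∈map∷covers⇒⋖ m with ∈-map⁻ _ m
  ... | _ , m′ , refl = there (∈covers⇒⋖ m′)

  ⋖-≤* : ∀ {Σ Σ′ Γ} → Σ ⋖ Σ′ → Σ′ ≤* Γ → Σ ≤* Γ
  ⋖-≤* (here A<B) c = merge A<B c
  ⋖-≤* (there s) (keep c) = keep (⋖-≤* s c)
  ⋖-≤* (there {A} (here {B₁} {B₂} {Σ} B₁<B₂)) (merge A<B₁B₂ c) =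
    let A<B₁ , A<B₂ = allLess-++ʳ⁻ B₁ A<B₁B₂ in
    merge A<B₁ (merge (AllP.++⁺ A<B₂ B₁<B₂) (subst (λ D → D ∷ Σ ≤* _) (sym (++-assoc A B₁ B₂)) c))
  ⋖-≤* (there (there s)) (merge A<B c) = merge A<B (⋖-≤* (there s) c)

  ∈reach⇒≤* : ∀ f {Σ Γ : SC N} → Γ ∈ reach f Σ → Σ ≤* Γ
  ∈reach⇒≤* zero    (here refl) = ≤*-refl _
  ∈reach⇒≤* (suc f) (here refl) = ≤*-refl _
  ∈reach⇒≤* (suc f) {Σ} (there m) with ∈-concatMap⁻′ (reach f) (covers Σ) m
  ... | _ , Σ′∈ , Γ∈ = ⋖-≤* (∈covers⇒⋖ Σ′∈) (∈reach⇒≤* f Γ∈)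

  ∈upSet⇒≤* : ∀ {Σ Γ} → Γ ∈ upSet Σ → Σ ≤* Γ
  ∈upSet⇒≤* {Σ} m = ∈reach⇒≤* (length Σ) (∈-deduplicate⁻ _≟SC_ (reach (length Σ) Σ) m)

  reach-∷ : ∀ f (A : Block N) {Σ Γ} → Γ ∈ reach f Σ → A ∷ Γ ∈ reach f (A ∷ Σ)
  reach-∷ zero    A (here refl) = here refl
  reach-∷ (suc f) A (here refl) = here refl
  reach-∷ (suc f) A {Σ} (there m) with ∈-concatMap⁻′ (reach f) (covers Σ) m
  ... | _ , Σ′∈ , Γ∈ =
    there (∈-concatMap⁺′ (reach f) (⋖⇒∈covers (there {A = A} (∈covers⇒⋖ {Σ} Σ′∈))) (reach-∷ f A Γ∈))

  reach-suc : ∀ f {Σ Γ : SC N} → Γ ∈ reach f Σ → Γ ∈ reach (suc f) Σ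
  reach-suc zero    (here refl) = here refl
  reach-suc (suc f) (here refl) = here refl
  reach-suc (suc f) {Σ} (there m) with ∈-concatMap⁻′ (reach f) (covers Σ) m
  ... | _ , Σ′∈ , Γ∈ = there (∈-concatMap⁺′ (reach (suc f)) Σ′∈ (reach-suc f Γ∈))

  ≤*⇒∈reach : ∀ {Σ Γ} → Σ ≤* Γ → Γ ∈ reach (length Σ) Σ
  ≤*⇒∈reach [] = here refl
  ≤*⇒∈reach (keep {A} {Σ} c) = reach-suc (length Σ) (reach-∷ (length Σ) A (≤*⇒∈reach c))
  ≤*⇒∈reach (merge {Σ = Σ} A<B c) =
    there (∈-concatMap⁺′ (reach (suc (length Σ))) (⋖⇒∈covers (here A<B)) (≤*⇒∈reach c))

  ≤*⇒∈upSet : ∀ {Σ Γ} → Σ ≤* Γ → Γ ∈ upSet Σ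
  ≤*⇒∈upSet c = ∈-deduplicate⁺ _≟SC_ (≤*⇒∈reach c)

  Unique-upSet : ∀ (Σ : SC N) → Unique (upSet Σ)
  Unique-upSet Σ = UniqueDecP.deduplicate-! _≟SC_ (reach (length Σ) Σ)

  ≤*-concat : ∀ {Σ Γ} → Σ ≤* Γ → concat Σ ≡ concat Γ
  ≤*-concat []                    = refl
  ≤*-concat (keep {A} c)          = cong (A ++_) (≤*-concat c)
  ≤*-concat (merge {A} {B} {Σ} _ c) = trans (sym (++-assoc A B (concat Σ))) (≤*-concat c)

  ≤*-++ : ∀ {Σ Γ Σ′ Γ′} → Σ ≤* Γ → Σ′ ≤* Γ′ → Σ ++ Σ′ ≤* Γ ++ Γ′
  ≤*-++ []          c′ = c′
  ≤*-++ (keep c)    c′ = keep (≤*-++ c c′)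
  ≤*-++ (merge p c) c′ = merge p (≤*-++ c c′)

  ≤*-All : ∀ {Q : Block N → Set} → (∀ {A B} → allLess A B → Q A → Q B → Q (A ++ B)) →
           ∀ {Σ Γ} → All Q Σ → Σ ≤* Γ → All Q Γ
  ≤*-All Q-++ []               []            = []
  ≤*-All Q-++ (qA ∷ qΣ)        (keep c)      = qA ∷ ≤*-All Q-++ qΣ c
  ≤*-All Q-++ (qA ∷ qB ∷ qΣ)   (merge A<B c) = ≤*-All Q-++ (Q-++ A<B qA qB ∷ qΣ) c

  ≤*-nonEmpty : ∀ {Σ Γ} → All NonEmpty Σ → Σ ≤* Γ → All NonEmpty Γ
  ≤*-nonEmpty = ≤*-All nonEmpty-++
    where
    nonEmpty-++ : ∀ {A B : Block N} → allLess A B → NonEmpty A → NonEmpty B → NonEmpty (A ++ B)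
    nonEmpty-++ {[]}    _ A≢[] _ = ⊥-elim (A≢[] refl)
    nonEmpty-++ {_ ∷ _} _ _ _ ()

  ≤*-sorted : ∀ {Σ Γ} → All (AllPairs _<_) Σ → Σ ≤* Γ → All (AllPairs _<_) Γ
  ≤*-sorted = ≤*-All (λ A<B sA sB → AllPairsP.++⁺ sA sB A<B)

  ≤*-[]⁻ : ∀ {Σ} → Σ ≤* [] → Σ ≡ []
  ≤*-[]⁻ [] = refl
  ≤*-[]⁻ (merge _ c) with ≤*-[]⁻ c
  ... | ()

  ≤*-head-prefix : ∀ {A Σ B Γ} → A ∷ Σ ≤* B ∷ Γ → ∃ λ r → B ≡ A ++ r
  ≤*-head-prefix {A} (keep _) = [] , sym (++-identityʳ A)
  ≤*-head-prefix {A} (merge {B = A′} _ c) with ≤*-head-prefix c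
  ... | r , B≡ = A′ ++ r , trans B≡ (++-assoc A A′ r)

  ≤*-uncons : ∀ {Σ D Γ} → Σ ≤* D ∷ Γ → ∃₂ λ Σ₁ Σ₂ → Σ ≡ Σ₁ ++ Σ₂ × Σ₁ ≤* [ D ] × Σ₂ ≤* Γ
  ≤*-uncons (keep {A} {Σ} c) = [ A ] , Σ , refl , keep [] , c
  ≤*-uncons (merge {A} {B} A<B c) with ≤*-uncons c
  ... | [] , _ , _ , () , _
  ... | _ ∷ Σ₁ , Σ₂ , refl , c₁ , c₂ = A ∷ B ∷ Σ₁ , Σ₂ , refl , merge A<B c₁ , c₂

  ≤*-prepend : ∀ {D A Σ E} → A ∷ Σ ≤* [ E ] → allLess D E → (D ++ A) ∷ Σ ≤* [ D ++ E ]
  ≤*-prepend (keep c) D<E with ≤*-[]⁻ c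
  ... | refl = keep []
  ≤*-prepend {D} {A} (merge {B = A′} {Σ = Σ} A<A′ c) D<E with ≤*-head-prefix c
  ... | r , refl =
    let D<A′ = proj₂ (allLess-++ʳ⁻ A (proj₁ (allLess-++ʳ⁻ (A ++ A′) D<E))) in
    merge (AllP.++⁺ D<A′ A<A′) (subst (λ H → H ∷ Σ ≤* [ D ++ (A ++ A′) ++ r ]) (sym (++-assoc D A A′)) (≤*-prepend c D<E))

  ≤*-graft : ∀ {Σ₁ D Γ Δ} → Σ₁ ≤* [ D ] → D ∷ Γ ≤* Δ → Σ₁ ++ Γ ≤* Δ
  ≤*-graft (keep c) c′ with ≤*-[]⁻ c
  ... | refl = c′
  ≤*-graft (merge A<B c) c′ = merge A<B (≤*-graft c c′)

  ≤*-join : ∀ {Σ₁ Σ₂ D E} → Σ₁ ≤* [ D ] → Σ₂ ≤* [ E ] → allLess D E → Σ₁ ++ Σ₂ ≤* [ D ++ E ]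
  ≤*-join {Σ₂ = []} _ () _
  ≤*-join {Σ₂ = A ∷ _} c₁ c₂ D<E with ≤*-head-prefix c₂
  ... | r , refl = ≤*-graft c₁ (merge (proj₁ (allLess-++ʳ⁻ A D<E)) (≤*-prepend c₂ D<E))

  data _≤*⟨_⟩ : SC N → Block N → Set where
    []    : [] ≤*⟨ [] ⟩
    block : ∀ {Σ B} → Σ ≤* [ B ] → Σ ≤*⟨ B ⟩

  ≤*-uncons⟨⟩ : ∀ B Γ {Σ} → Σ ≤* removeEmpty (B ∷ Γ) →
                ∃₂ λ Σ₁ Σ₂ → Σ ≡ Σ₁ ++ Σ₂ × Σ₁ ≤*⟨ B ⟩ × Σ₂ ≤* removeEmpty Γ
  ≤*-uncons⟨⟩ []      Γ c = [] , _ , refl , [] , c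
  ≤*-uncons⟨⟩ (_ ∷ _) Γ c with ≤*-uncons c
  ... | Σ₁ , Σ₂ , refl , c₁ , c₂ = Σ₁ , Σ₂ , refl , block c₁ , c₂

  ≤*⟨⟩-join : ∀ {Σ₁ Σ₂ D E} → NonEmpty (D ++ E) → Σ₁ ≤*⟨ D ⟩ → Σ₂ ≤*⟨ E ⟩ → allLess D E →
              Σ₁ ++ Σ₂ ≤* [ D ++ E ]
  ≤*⟨⟩-join DE≢[] []         []          _   = ⊥-elim (DE≢[] refl)
  ≤*⟨⟩-join _     []         (block c)   _   = c
  ≤*⟨⟩-join {Σ₁} {D = D} _ (block c) [] _   =
    subst₂ (λ Σ B → Σ ≤* [ B ]) (sym (++-identityʳ Σ₁)) (sym (++-identityʳ D)) c
  ≤*⟨⟩-join _     (block c₁) (block c₂) D<E = ≤*-join c₁ c₂ D<E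

-- Restriction to a subset and transport along order embeddings

module _ {N : ℕ} {P : Pred (Fin N) 0ℓ} (P? : Decidable P) where

  restrict : SC N → SC N
  restrict Σ = removeEmpty (map (filter P?) Σ)

  ≤*-restrict : ∀ {Σ Γ} → Σ ≤* Γ → restrict Σ ≤* restrict Γ
  ≤*-restrict []       = []
  ≤*-restrict (keep {A} c) = keep-nonEmpty (filter P? A) (≤*-restrict c)
    where
    keep-nonEmpty : ∀ A {Σ Γ} → removeEmpty Σ ≤* removeEmpty Γ → removeEmpty (A ∷ Σ) ≤* removeEmpty (A ∷ Γ)
    keep-nonEmpty []      c = c
    keep-nonEmpty (_ ∷ _) c = keep c
  ≤*-restrict (merge {A} {B} {Σ} A<B c) =
    merge-nonEmpty (filter P? A) (filter P? B)
      (AllP.filter⁺ P? (All.map (AllP.filter⁺ P?) A<B))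
      (subst (λ H → removeEmpty (H ∷ map (filter P?) Σ) ≤* _) (filter-++ P? A B) (≤*-restrict c))
    where
    merge-nonEmpty : ∀ A B {Σ Γ} → allLess A B →
                     removeEmpty ((A ++ B) ∷ Σ) ≤* Γ → removeEmpty (A ∷ B ∷ Σ) ≤* Γ
    merge-nonEmpty []      _       _   c = c
    merge-nonEmpty (x ∷ A) []      _   c = subst (λ H → (x ∷ H) ∷ _ ≤* _) (++-identityʳ A) c
    merge-nonEmpty (_ ∷ _) (_ ∷ _) A<B c = merge A<B c

  restrict-blocks : ∀ Σ → All (λ b → NonEmpty b × All P b) (restrict Σ)
  restrict-blocks []      = []
  restrict-blocks (B ∷ Σ) with filter P? B | AllP.all-filter P? B
  ... | []    | _   = restrict-blocks Σ
  ... | _ ∷ _ | all = ((λ ()) , all) ∷ restrict-blocks Σ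

  restrict-Interleaving : ∀ {X Y S} → All (λ b → NonEmpty b × All P b) X → All (All (¬_ ∘ P)) Y →
                          Interleaving X Y S → restrict S ≡ X
  restrict-Interleaving [] [] [] = refl
  restrict-Interleaving {B ∷ X} {S = _ ∷ S} ((B≢[] , pB) ∷ pX) ¬pY (consˡ sp) = begin
    removeEmpty (filter P? B ∷ map (filter P?) S) ≡⟨ cong (λ B′ → removeEmpty (B′ ∷ map (filter P?) S)) (filter-all P? pB) ⟩
    removeEmpty (B ∷ map (filter P?) S)           ≡⟨ removeEmpty-∷ B≢[] ⟩
    B ∷ restrict S                                ≡⟨ cong (B ∷_) (restrict-Interleaving pX ¬pY sp) ⟩
    B ∷ X                                         ∎
    where
    open ≡-Reasoning
    removeEmpty-∷ : ∀ {B Σ} → NonEmpty B → removeEmpty (B ∷ Σ) ≡ B ∷ removeEmpty Σ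
    removeEmpty-∷ {[]}    B≢[] = ⊥-elim (B≢[] refl)
    removeEmpty-∷ {_ ∷ _} _    = refl
  restrict-Interleaving {S = B ∷ S} pX (¬pB ∷ ¬pY) (consʳ sp) =
    trans (cong (λ B′ → removeEmpty (B′ ∷ map (filter P?) S)) (filter-none P? ¬pB)) (restrict-Interleaving pX ¬pY sp)

  ∩-filter : ∀ {H B : Block N} → AllPairs _<_ H → AllPairs _<_ B →
             (∀ {x} → x ∈ H → P x) → (∀ {x} → P x → x ∈ H) → H ∩ B ≡ filter P? B
  ∩-filter {H} {B} sH sB H⊆P P⊆H = sorted-extensional FP.<-irrefl FP.<-asym
    (AllPairsP.filter⁺ (_∈? B) sH) (AllPairsP.filter⁺ P? sB)
    (λ x∈ → let x∈H , x∈B = ∈-filter⁻ (_∈? B) {xs = H} x∈ in ∈-filter⁺ P? x∈B (H⊆P x∈H))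
    (λ x∈ → let x∈B , px = ∈-filter⁻ P? {xs = B} x∈ in ∈-filter⁺ (_∈? B) (P⊆H px) x∈B)
    where open DecMembership FP._≟_ using (_∈?_)

module _ {a b : ℕ} (f : Fin a → Fin b) where

  ≤*-map : (∀ {x y} → x < y → f x < f y) → ∀ {Σ Γ} → Σ ≤* Γ → map (map f) Σ ≤* map (map f) Γ
  ≤*-map f-mono []                        = []
  ≤*-map f-mono (keep c)                  = keep (≤*-map f-mono c)
  ≤*-map f-mono (merge {A} {B} {Σ} A<B c) =
    merge (AllP.map⁺ (All.map (λ x<B → AllP.map⁺ (All.map f-mono x<B)) A<B))
          (subst (λ H → H ∷ map (map f) Σ ≤* _) (map-++ f A B) (≤*-map f-mono c))

  ≤*-map⁻ : (∀ {x y} → f x < f y → x < y) →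
            ∀ Φ {Σ Γ} → Σ ≡ map (map f) Φ → Σ ≤* Γ → ∃ λ Φ′ → Γ ≡ map (map f) Φ′ × Φ ≤* Φ′
  ≤*-map⁻ f-reflect []          refl [] = [] , refl , []
  ≤*-map⁻ f-reflect (A ∷ Φ)     Σ≡ (keep c) with ∷-injectiveˡ Σ≡
  ... | refl with ≤*-map⁻ f-reflect Φ (∷-injectiveʳ Σ≡) c
  ...   | Φ′ , refl , c′ = A ∷ Φ′ , refl , keep c′
  ≤*-map⁻ f-reflect (A ∷ B ∷ Φ) Σ≡ (merge fA<fB c) with ∷-injectiveˡ Σ≡ | ∷-injectiveˡ (∷-injectiveʳ Σ≡)
  ... | refl | refl
    with ≤*-map⁻ f-reflect ((A ++ B) ∷ Φ) (cong₂ _∷_ (sym (map-++ f A B)) (∷-injectiveʳ (∷-injectiveʳ Σ≡))) c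
  ...   | Φ′ , Γ≡ , c′ = Φ′ , Γ≡ , merge (All.map (λ x<B → All.map f-reflect (AllP.map⁻ x<B)) (AllP.map⁻ fA<fB)) c′

-- Enumeration of set compositions

allFin-sorted : ∀ K → AllPairs _<_ (allFin K)
allFin-sorted K = AllPairsP.tabulate⁺-< (λ i<j → i<j)

allFuns-complete : ∀ N K (w : Fin K → Fin N) → ∃ λ w′ → w′ ∈ allFuns N K × (∀ i → w′ i ≡ w i)
allFuns-complete N zero    w = (λ ()) , here refl , λ ()
allFuns-complete N (suc K) w with allFuns-complete N K (w ∘ F.suc)
... | w′ , w′∈ , w′≗w = w F.zero ∷ᶠ w′ ,
      ∈-concatMap⁺′ (λ j → map (j ∷ᶠ_) (allFuns N K)) (∈-allFin (w F.zero)) (∈-map⁺ (w F.zero ∷ᶠ_) w′∈) ,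
      λ { F.zero → refl ; (F.suc i) → w′≗w i }

module _ {N : ℕ} where

  blockAt : ℕ → SC N → Block N
  blockAt k       []      = []
  blockAt zero    (B ∷ Γ) = B
  blockAt (suc k) (B ∷ Γ) = blockAt k Γ

  blockIndex : SC N → Fin N → ℕ
  blockIndex []      x = 0
  blockIndex (B ∷ Γ) x with DecMembership._∈?_ FP._≟_ x B
  ... | yes _ = 0
  ... | no  _ = suc (blockIndex Γ x)

  blockIndex<length : ∀ Γ {x} → x ∈ concat Γ → blockIndex Γ x ℕ.< length Γ
  blockIndex<length (B ∷ Γ) {x} x∈ with DecMembership._∈?_ FP._≟_ x B
  ... | yes _ = z<s
  ... | no x∉B with ∈-++⁻ B x∈
  ...   | inj₁ x∈B = ⊥-elim (x∉B x∈B)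
  ...   | inj₂ x∈Γ = s<s (blockIndex<length Γ x∈Γ)

  blockAt⊆concat : ∀ k Γ {x} → x ∈ blockAt k Γ → x ∈ concat Γ
  blockAt⊆concat zero    (B ∷ Γ) x∈ = ∈-++⁺ˡ x∈
  blockAt⊆concat (suc k) (B ∷ Γ) x∈ = ∈-++⁺ʳ B (blockAt⊆concat k Γ x∈)

  ∈blockAt⇒blockIndex : ∀ k Γ {x} → Unique (concat Γ) → x ∈ blockAt k Γ → blockIndex Γ x ≡ k
  ∈blockAt⇒blockIndex k (B ∷ Γ) {x} Γ! x∈ with DecMembership._∈?_ FP._≟_ x B | k
  ... | yes _   | zero  = refl
  ... | no x∉B  | zero  = ⊥-elim (x∉B x∈)
  ... | yes x∈B | suc k = ⊥-elim (disjoint B Γ! x∈B (blockAt⊆concat k Γ x∈))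
    where
    disjoint : ∀ B {R x} → Unique (B ++ R) → x ∈ B → x ∈ R → ⊥
    disjoint (_ ∷ B) (b∉ ∷ _) (here refl) x∈R = All.lookup b∉ (∈-++⁺ʳ B x∈R) refl
    disjoint (_ ∷ B) (_ ∷ B!) (there x∈B) x∈R = disjoint B B! x∈B x∈R
  ... | no _    | suc k = cong suc (∈blockAt⇒blockIndex k Γ (drop B Γ!) x∈)
    where
    drop : ∀ B {R} → Unique (B ++ R) → Unique R
    drop []      R! = R!
    drop (_ ∷ B) (_ ∷ BR!) = drop B BR!

  blockIndex⇒∈blockAt : ∀ k Γ {x} → x ∈ concat Γ → blockIndex Γ x ≡ k → x ∈ blockAt k Γ
  blockIndex⇒∈blockAt k (B ∷ Γ) {x} x∈ idx≡k with DecMembership._∈?_ FP._≟_ x B | k | idx≡k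
  ... | yes x∈B | zero  | _    = x∈B
  ... | no x∉B  | suc k | idx≡ with ∈-++⁻ B x∈
  ...   | inj₁ x∈B = ⊥-elim (x∉B x∈B)
  ...   | inj₂ x∈Γ = blockIndex⇒∈blockAt k Γ x∈Γ (ℕP.suc-injective idx≡)

  blockAt-All : ∀ {Q : Block N → Set} k Γ → Q [] → All Q Γ → Q (blockAt k Γ)
  blockAt-All k       []      q[] []       = q[]
  blockAt-All zero    (B ∷ Γ) _   (qB ∷ _) = qB
  blockAt-All (suc k) (B ∷ Γ) q[] (_ ∷ qΓ) = blockAt-All k Γ q[] qΓ

  length≤length-concat : ∀ (Γ : SC N) → All NonEmpty Γ → length Γ ℕ.≤ length (concat Γ)
  length≤length-concat []            []       = ℕ.z≤n
  length≤length-concat ([] ∷ Γ)      (B≢[] ∷ _) = ⊥-elim (B≢[] refl)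
  length≤length-concat ((b ∷ B) ∷ Γ) (_ ∷ Γ≢[]) = begin
    suc (length Γ)                ≤⟨ s<s (length≤length-concat Γ Γ≢[]) ⟩
    suc (length (concat Γ))       ≤⟨ s<s (ℕP.m≤n+m _ (length B)) ⟩
    suc (length B + length (concat Γ)) ≡⟨ cong suc (length-++ B) ⟨
    suc (length (B ++ concat Γ))  ∎
    where open ℕP.≤-Reasoning

  removeEmpty-blockAt : ∀ K Γ → length Γ ℕ.≤ K → All NonEmpty Γ →
                        removeEmpty (tabulate (λ (j : Fin K) → blockAt (toℕ j) Γ)) ≡ Γ
  removeEmpty-blockAt zero    []      _         _ = refl
  removeEmpty-blockAt (suc K) []      _         _ = removeEmpty-blockAt K [] ℕ.z≤n []
  removeEmpty-blockAt (suc K) (B ∷ Γ) (s<s len≤) (B≢[] ∷ Γ≢[]) with B | B≢[]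
  ... | []    | B≢[] = ⊥-elim (B≢[] refl)
  ... | _ ∷ _ | _    = cong (_ ∷_) (removeEmpty-blockAt K Γ len≤ Γ≢[])

  -- Γ = blocksOf w, where w sends x to the index of the block of Γ containing x.
  IsSetComp⇒∈allSC : ∀ Γ → IsSetComp N Γ → Γ ∈ allSC N
  IsSetComp⇒∈allSC Γ (Γ≢[] , Γ-sorted , Γ↭) =
    ∈-deduplicate⁺ _≟SC_ (subst (_∈ map blocksOf (allFuns N N)) blocksOf-w′ (∈-map⁺ blocksOf w′∈))
    where
    ∈Γ : ∀ x → x ∈ concat Γ
    ∈Γ x = ↭P.∈-resp-↭ (↭-sym Γ↭) (∈-allFin x)
    Γ! : Unique (concat Γ)
    Γ! = Unique-resp-↭ (↭-sym Γ↭) (UniqueP.allFin⁺ N)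
    length-Γ≤N : length Γ ℕ.≤ N
    length-Γ≤N = ℕP.≤-trans (length≤length-concat Γ Γ≢[])
                            (ℕP.≤-reflexive (trans (↭P.↭-length Γ↭) (length-tabulate (λ i → i))))
    w : Fin N → Fin N
    w x = fromℕ< (ℕP.<-≤-trans (blockIndex<length Γ (∈Γ x)) length-Γ≤N)
    toℕ-w : ∀ x → toℕ (w x) ≡ blockIndex Γ x
    toℕ-w x = FP.toℕ-fromℕ< _
    w′ = proj₁ (allFuns-complete N N w)
    w′∈ = proj₁ (proj₂ (allFuns-complete N N w))
    toℕ-w′ : ∀ x → toℕ (w′ x) ≡ blockIndex Γ x
    toℕ-w′ x = trans (cong toℕ (proj₂ (proj₂ (allFuns-complete N N w)) x)) (toℕ-w x)
    block-w′ : ∀ j → filter (λ i → w′ i FP.≟ j) (allFin N) ≡ blockAt (toℕ j) Γ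
    block-w′ j = sorted-extensional FP.<-irrefl FP.<-asym
      (AllPairsP.filter⁺ (λ i → w′ i FP.≟ j) (allFin-sorted N))
      (blockAt-All (toℕ j) Γ [] (All.map (LinkedP.Linked⇒AllPairs FP.<-trans) Γ-sorted))
      (λ {x} x∈ → blockIndex⇒∈blockAt (toℕ j) Γ (∈Γ x)
                    (trans (sym (toℕ-w′ x)) (cong toℕ (proj₂ (∈-filter⁻ (λ i → w′ i FP.≟ j) {xs = allFin N} x∈)))))
      (λ {x} x∈ → ∈-filter⁺ (λ i → w′ i FP.≟ j) (∈-allFin x)
                    (FP.toℕ-injective (trans (toℕ-w′ x) (∈blockAt⇒blockIndex (toℕ j) Γ Γ! x∈))))
    blocksOf-w′ : blocksOf w′ ≡ Γ
    blocksOf-w′ = trans (cong removeEmpty (trans (map-cong block-w′ (allFin N)) (map-tabulate (λ i → i) _)))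
                        (removeEmpty-blockAt N Γ length-Γ≤N Γ≢[])

  Unique-allSC : Unique (allSC N)
  Unique-allSC = UniqueDecP.deduplicate-! _≟SC_ (map blocksOf (allFuns N N))

  ∈allSC⇒blocks : ∀ {Γ} → Γ ∈ allSC N → All NonEmpty Γ × All (AllPairs _<_) Γ
  ∈allSC⇒blocks m with ∈-map⁻ blocksOf (∈-deduplicate⁻ _≟SC_ (map blocksOf (allFuns N N)) m)
  ... | w , _ , refl =
    AllP.all-filter nonEmpty? blocks ,
    AllP.filter⁺ nonEmpty? (AllP.map⁺ (All.universal (λ j → AllPairsP.filter⁺ (λ i → w i FP.≟ j) (allFin-sorted N)) (allFin N)))
    where
    nonEmpty? = λ (b : Block N) → ¬? (b ≟B [])
    blocks = map (λ j → filter (λ i → w i FP.≟ j) (allFin N)) (allFin N)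

-- The two halves of [n + m]

module Halves (n m : ℕ) where

  IsLeft IsRight : Pred (Fin (n + m)) 0ℓ
  IsLeft  x = toℕ x ℕ.< n
  IsRight x = n ℕ.≤ toℕ x

  isLeft? : Decidable IsLeft
  isLeft? x = toℕ x ℕ.<? n

  isRight? : Decidable IsRight
  isRight? x = n ℕ.≤? toℕ x

  left⇒¬right : ∀ {x} → IsLeft x → ¬ IsRight x
  left⇒¬right = ℕP.<⇒≱

  right⇒¬left : ∀ {x} → IsRight x → ¬ IsLeft x
  right⇒¬left r l = left⇒¬right l r

  left<right : ∀ {x y} → IsLeft x → IsRight y → x < y
  left<right = ℕP.<-≤-trans

  isLeft-↑ˡ : ∀ i → IsLeft (i ↑ˡ m)
  isLeft-↑ˡ i = subst (ℕ._< n) (sym (FP.toℕ-↑ˡ i m)) (FP.toℕ<n i)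

  isRight-↑ʳ : ∀ j → IsRight (n ↑ʳ j)
  isRight-↑ʳ j = subst (n ℕ.≤_) (sym (FP.toℕ-↑ʳ n j)) (ℕP.m≤m+n n (toℕ j))

  ↑ˡ-mono : ∀ {i j : Fin n} → i < j → i ↑ˡ m < j ↑ˡ m
  ↑ˡ-mono {i} {j} = subst₂ ℕ._<_ (sym (FP.toℕ-↑ˡ i m)) (sym (FP.toℕ-↑ˡ j m))

  ↑ˡ-reflect : ∀ {i j : Fin n} → i ↑ˡ m < j ↑ˡ m → i < j
  ↑ˡ-reflect {i} {j} = subst₂ ℕ._<_ (FP.toℕ-↑ˡ i m) (FP.toℕ-↑ˡ j m)

  ↑ʳ-mono : ∀ {i j : Fin m} → i < j → n ↑ʳ i < n ↑ʳ j
  ↑ʳ-mono {i} {j} i<j = subst₂ ℕ._<_ (sym (FP.toℕ-↑ʳ n i)) (sym (FP.toℕ-↑ʳ n j)) (ℕP.+-monoʳ-< n i<j)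

  ↑ʳ-reflect : ∀ {i j : Fin m} → n ↑ʳ i < n ↑ʳ j → i < j
  ↑ʳ-reflect {i} {j} p = ℕP.+-cancelˡ-< n _ _ (subst₂ ℕ._<_ (FP.toℕ-↑ʳ n i) (FP.toℕ-↑ʳ n j) p)

  left-or-right : ∀ x → (∃ λ i → x ≡ i ↑ˡ m) ⊎ (∃ λ j → x ≡ n ↑ʳ j)
  left-or-right x with F.splitAt n x in eq
  ... | inj₁ i = inj₁ (i , sym (FP.splitAt⁻¹-↑ˡ eq))
  ... | inj₂ j = inj₂ (j , sym (FP.splitAt⁻¹-↑ʳ eq))

  leftHalf rightHalf : Block (n + m)
  leftHalf  = map (_↑ˡ m) (allFin n)
  rightHalf = map (n ↑ʳ_) (allFin m)

  liftˡ : SC n → SC (n + m)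
  liftˡ = map (map (_↑ˡ m))

  liftʳ : SC m → SC (n + m)
  liftʳ = map (map (n ↑ʳ_))

  ∈leftHalf⇔ : ∀ {x} → (x ∈ leftHalf → IsLeft x) × (IsLeft x → x ∈ leftHalf)
  ∈leftHalf⇔ {x} = to , from
    where
    to : x ∈ leftHalf → IsLeft x
    to x∈ with ∈-map⁻ (_↑ˡ m) x∈
    ... | i , _ , refl = isLeft-↑ˡ i
    from : IsLeft x → x ∈ leftHalf
    from l with left-or-right x
    ... | inj₁ (i , refl) = ∈-map⁺ (_↑ˡ m) (∈-allFin i)
    ... | inj₂ (j , refl) = ⊥-elim (left⇒¬right l (isRight-↑ʳ j))

  ∈rightHalf⇔ : ∀ {x} → (x ∈ rightHalf → IsRight x) × (IsRight x → x ∈ rightHalf)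
  ∈rightHalf⇔ {x} = to , from
    where
    to : x ∈ rightHalf → IsRight x
    to x∈ with ∈-map⁻ (n ↑ʳ_) x∈
    ... | j , _ , refl = isRight-↑ʳ j
    from : IsRight x → x ∈ rightHalf
    from r with left-or-right x
    ... | inj₁ (i , refl) = ⊥-elim (left⇒¬right (isLeft-↑ˡ i) r)
    ... | inj₂ (j , refl) = ∈-map⁺ (n ↑ʳ_) (∈-allFin j)

  leftHalf-sorted : AllPairs _<_ leftHalf
  leftHalf-sorted = AllPairsP.map⁺ (AllPairs.map ↑ˡ-mono (allFin-sorted n))

  rightHalf-sorted : AllPairs _<_ rightHalf
  rightHalf-sorted = AllPairsP.map⁺ (AllPairs.map ↑ʳ-mono (allFin-sorted m))

  halves-++ : leftHalf ++ rightHalf ≡ allFin (n + m)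
  halves-++ = sorted-extensional FP.<-irrefl FP.<-asym
    (AllPairsP.++⁺ leftHalf-sorted rightHalf-sorted
       (All.tabulate (λ l → All.tabulate (λ r → left<right (proj₁ ∈leftHalf⇔ l) (proj₁ ∈rightHalf⇔ r)))))
    (allFin-sorted (n + m))
    (λ {x} _ → ∈-allFin x)
    (λ {x} _ → ∈halves x)
    where
    ∈halves : ∀ x → x ∈ leftHalf ++ rightHalf
    ∈halves x with left-or-right x
    ... | inj₁ (i , refl) = ∈-++⁺ˡ (∈-map⁺ (_↑ˡ m) (∈-allFin i))
    ... | inj₂ (j , refl) = ∈-++⁺ʳ leftHalf (∈-map⁺ (n ↑ʳ_) (∈-allFin j))

  leftPart rightPart : SC (n + m) → SC (n + m)
  leftPart  = restrict isLeft?
  rightPart = restrict isRight?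

  split-∧ : ∀ {Γ} → All (AllPairs _<_) Γ → split n m ∧ Γ ≡ leftPart Γ ++ rightPart Γ
  split-∧ {Γ} Γ-sorted = begin
    removeEmpty (map (leftHalf ∩_) Γ ++ map (rightHalf ∩_) Γ ++ [])
      ≡⟨ cong (λ Δ → removeEmpty (map (leftHalf ∩_) Γ ++ Δ)) (++-identityʳ _) ⟩
    removeEmpty (map (leftHalf ∩_) Γ ++ map (rightHalf ∩_) Γ)
      ≡⟨ filter-++ (λ b → ¬? (b ≟B [])) (map (leftHalf ∩_) Γ) (map (rightHalf ∩_) Γ) ⟩
    removeEmpty (map (leftHalf ∩_) Γ) ++ removeEmpty (map (rightHalf ∩_) Γ)
      ≡⟨ cong₂ (λ L R → removeEmpty L ++ removeEmpty R)
               (map-cong-local (All.map ∩leftHalf Γ-sorted)) (map-cong-local (All.map ∩rightHalf Γ-sorted)) ⟩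
    leftPart Γ ++ rightPart Γ ∎
    where
    open ≡-Reasoning
    ∩leftHalf = λ {B} sB → ∩-filter isLeft? {B = B} leftHalf-sorted sB (proj₁ ∈leftHalf⇔) (proj₂ ∈leftHalf⇔)
    ∩rightHalf = λ {B} sB → ∩-filter isRight? {B = B} rightHalf-sorted sB (proj₁ ∈rightHalf⇔) (proj₂ ∈rightHalf⇔)

  sorted-split : ∀ {B} → AllPairs _<_ B → B ≡ filter isLeft? B ++ filter isRight? B
  sorted-split [] = refl
  sorted-split {x ∷ B} (x<B ∷ sB) with isLeft? x
  ... | yes l = begin
    x ∷ B                                              ≡⟨ cong (x ∷_) (sorted-split sB) ⟩
    x ∷ (filter isLeft? B ++ filter isRight? B)
      ≡⟨ cong₂ _++_ (filter-accept isLeft? l) (filter-reject isRight? (left⇒¬right l)) ⟨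
    filter isLeft? (x ∷ B) ++ filter isRight? (x ∷ B)  ∎
    where open ≡-Reasoning
  ... | no ¬l = begin
    x ∷ B                                              ≡⟨ filter-all isRight? all-right ⟨
    filter isRight? (x ∷ B)                            ≡⟨ cong (_++ filter isRight? (x ∷ B)) (filter-none isLeft? none-left) ⟨
    filter isLeft? (x ∷ B) ++ filter isRight? (x ∷ B)  ∎
    where
    open ≡-Reasoning
    x-right = ℕP.≮⇒≥ ¬l
    all-right = x-right ∷ All.map (λ x<y → ℕP.≤-trans x-right (ℕP.<⇒≤ x<y)) x<B
    none-left = ¬l ∷ All.map (λ x<y l → ¬l (ℕP.<-trans x<y l)) x<B

  -- A sorted block of Γ is its left part followed by its right part, so the pieces of X and of Y
  -- below these two parts can be set side by side.
  ≤*-interleave : ∀ Γ {X Y} → All NonEmpty Γ → All (AllPairs _<_) Γ → X ≤* leftPart Γ → Y ≤* rightPart Γ →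
                  ∃ λ S → Interleaving X Y S × S ≤* Γ
  ≤*-interleave [] _ _ cX cY with ≤*-[]⁻ cX | ≤*-[]⁻ cY
  ... | refl | refl = [] , [] , []
  ≤*-interleave (B ∷ Γ) (B≢[] ∷ Γ≢[]) (sB ∷ sΓ) cX cY
    with ≤*-uncons⟨⟩ (filter isLeft? B) (map (filter isLeft?) Γ) cX
       | ≤*-uncons⟨⟩ (filter isRight? B) (map (filter isRight?) Γ) cY
  ... | X₁ , X₂ , refl , cX₁ , cX₂ | Y₁ , Y₂ , refl , cY₁ , cY₂ with ≤*-interleave Γ Γ≢[] sΓ cX₂ cY₂
  ... | S , sp , cS =
    (X₁ ++ Y₁) ++ S ,
    InterleavingP.++⁺ {A = Block (n + m)} (InterleavingP.++-linear X₁ Y₁) sp ,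
    ≤*-++ (subst (λ B′ → X₁ ++ Y₁ ≤* [ B′ ]) (sym B≡)
                 (≤*⟨⟩-join (subst NonEmpty B≡ B≢[]) cX₁ cY₁ left<rightB)) cS
    where
    B≡ = sorted-split sB
    left<rightB = All.map (λ l → All.map (left<right l) (AllP.all-filter isRight? B)) (AllP.all-filter isLeft? B)

  liftˡ-blocks : ∀ {Φ} → All NonEmpty Φ → All (λ b → NonEmpty b × All IsLeft b) (liftˡ Φ)
  liftˡ-blocks = AllP.map⁺ ∘ All.map λ {B} B≢[] → nonEmpty-map B≢[] , AllP.map⁺ (All.universal isLeft-↑ˡ B)

  liftʳ-blocks : ∀ {Ψ} → All NonEmpty Ψ → All (λ b → NonEmpty b × All IsRight b) (liftʳ Ψ)
  liftʳ-blocks = AllP.map⁺ ∘ All.map λ {B} B≢[] → nonEmpty-map B≢[] , AllP.map⁺ (All.universal isRight-↑ʳ B)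

  liftʳ-right : ∀ Ψ → All (All IsRight) (liftʳ Ψ)
  liftʳ-right = AllP.map⁺ ∘ All.universal (λ B → AllP.map⁺ (All.universal isRight-↑ʳ B))

  right⇒¬anyLeft : ∀ {B} → All IsRight B → ¬ Any IsLeft B
  right⇒¬anyLeft rB lB = let _ , x∈ , l = find lB in left⇒¬right l (All.lookup rB x∈)

  anyLeft-liftˡ : ∀ {Φ} → All NonEmpty Φ → All (Any IsLeft) (liftˡ Φ)
  anyLeft-liftˡ = All.map (λ (B≢[] , lB) → nonEmpty-All⇒Any B≢[] lB) ∘ liftˡ-blocks

  noneLeft-liftʳ : ∀ Ψ → All (¬_ ∘ Any IsLeft) (liftʳ Ψ)
  noneLeft-liftʳ = All.map right⇒¬anyLeft ∘ liftʳ-right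

  ∣-injective : ∀ {Φ₁ Φ₂ Ψ₁ Ψ₂} → All NonEmpty Φ₁ → All NonEmpty Φ₂ →
                Φ₁ ∣ Ψ₁ ≡ Φ₂ ∣ Ψ₂ → Φ₁ ≡ Φ₂ × Ψ₁ ≡ Ψ₂
  ∣-injective {Ψ₁ = Ψ₁} {Ψ₂} Φ₁≢[] Φ₂≢[] eq =
    let Φ≡ , Ψ≡ = ++-cancel-separated (anyLeft-liftˡ Φ₁≢[]) (noneLeft-liftʳ Ψ₁)
                                      (anyLeft-liftˡ Φ₂≢[]) (noneLeft-liftʳ Ψ₂) eq in
    map-injective (map-injective (FP.↑ˡ-injective m _ _)) Φ≡ , map-injective (map-injective (FP.↑ʳ-injective n _ _)) Ψ≡

  parts≡lifts : ∀ {Γ Φ′ Ψ′} → All (AllPairs _<_) Γ → All NonEmpty Φ′ → split n m ∧ Γ ≡ Φ′ ∣ Ψ′ →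
                leftPart Γ ≡ liftˡ Φ′ × rightPart Γ ≡ liftʳ Ψ′
  parts≡lifts {Γ} {Ψ′ = Ψ′} Γ-sorted Φ′≢[] eq =
    ++-cancel-separated
      (All.map (λ (B≢[] , lB) → nonEmpty-All⇒Any B≢[] lB) (restrict-blocks isLeft? Γ))
      (All.map (right⇒¬anyLeft ∘ proj₂) (restrict-blocks isRight? Γ))
      (anyLeft-liftˡ Φ′≢[]) (noneLeft-liftʳ Ψ′)
      (trans (sym (split-∧ Γ-sorted)) eq)

  concat-lifts-↭ : ∀ {Φ Ψ} → concat Φ ↭ allFin n → concat Ψ ↭ allFin m →
                   concat (liftˡ Φ) ++ concat (liftʳ Ψ) ↭ allFin (n + m)
  concat-lifts-↭ {Φ} {Ψ} Φ↭ Ψ↭ =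
    ↭-trans (↭P.++⁺ (↭-trans (↭-reflexive (concat-map Φ)) (↭P.map⁺ (_↑ˡ m) Φ↭))
                    (↭-trans (↭-reflexive (concat-map Ψ)) (↭P.map⁺ (n ↑ʳ_) Ψ↭)))
            (↭-reflexive halves-++)

  shuffle-≤*-IsSetComp : ∀ {Φ Ψ S Γ} → IsSetComp n Φ → IsSetComp m Ψ →
                         Interleaving (liftˡ Φ) (liftʳ Ψ) S → S ≤* Γ → IsSetComp (n + m) Γ
  shuffle-≤*-IsSetComp {Φ} {Ψ} (Φ≢[] , Φ-sorted , Φ↭) (Ψ≢[] , Ψ-sorted , Ψ↭) sp c =
    ≤*-nonEmpty (Interleaving-All (All.map proj₁ (liftˡ-blocks Φ≢[])) (All.map proj₁ (liftʳ-blocks Ψ≢[])) sp) c ,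
    All.map (LinkedP.AllPairs⇒Linked) (≤*-sorted (Interleaving-All (lift-sorted ↑ˡ-mono Φ-sorted) (lift-sorted ↑ʳ-mono Ψ-sorted) sp) c) ,
    ↭-trans (↭-reflexive (sym (≤*-concat c)))
   (↭-trans (concat⁺-↭ (Interleaving.toPermutation sp))
   (↭-trans (↭-reflexive (sym (concat-++ (liftˡ Φ) (liftʳ Ψ)))) (concat-lifts-↭ {Φ} {Ψ} Φ↭ Ψ↭)))
    where
    lift-sorted : ∀ {K} {f : Fin K → Fin (n + m)} → (∀ {x y} → x < y → f x < f y) →
                  ∀ {Σ} → All (Linked _<_) Σ → All (AllPairs _<_) (map (map f) Σ)
    lift-sorted f-mono = AllP.map⁺ ∘ All.map (AllPairsP.map⁺ ∘ AllPairs.map f-mono ∘ LinkedP.Linked⇒AllPairs FP.<-trans)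

  parts⇒shuffle-≤* : ∀ {Φ Ψ Φ′ Ψ′ Γ} → All NonEmpty Γ → All (AllPairs _<_) Γ →
                     leftPart Γ ≡ liftˡ Φ′ → rightPart Γ ≡ liftʳ Ψ′ → Φ ≤* Φ′ → Ψ ≤* Ψ′ →
                     ∃ λ S → Interleaving (liftˡ Φ) (liftʳ Ψ) S × S ≤* Γ
  parts⇒shuffle-≤* {Φ} {Ψ} Γ≢[] Γ-sorted left≡ right≡ cΦ cΨ =
    ≤*-interleave _ Γ≢[] Γ-sorted (subst (liftˡ Φ ≤*_) (sym left≡) (≤*-map (_↑ˡ m) ↑ˡ-mono cΦ))
                                  (subst (liftʳ Ψ ≤*_) (sym right≡) (≤*-map (n ↑ʳ_) ↑ʳ-mono cΨ))

-- Sums of distinct basis elements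

unitTerms : ∀ {K} → List (SC K) → NCQSym
unitTerms {K} Γs = map (1ℚ ,_) (map (K ,_) Γs)

unitTerms-++ : ∀ {K} (Γs Δs : List (SC K)) → unitTerms (Γs ++ Δs) ≡ unitTerms Γs ++ unitTerms Δs
unitTerms-++ {K} Γs Δs = trans (cong (map (1ℚ ,_)) (map-++ (K ,_) Γs Δs)) (map-++ (1ℚ ,_) (map (K ,_) Γs) _)

sumN-M : ∀ {K} (Γs : List (SC K)) → sumN (map M Γs) ≡ unitTerms Γs
sumN-M []       = refl
sumN-M (_ ∷ Γs) = cong (_ ∷_) (sumN-M Γs)

scale-sumN-M : ∀ {K} (Γs : List (SC K)) → scale (1ℚ *ℚ 1ℚ) (sumN (map M Γs)) ≡ unitTerms Γs
scale-sumN-M []       = refl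
scale-sumN-M (_ ∷ Γs) = cong (_ ∷_) (scale-sumN-M Γs)

sumN-map-Q : ∀ {K} (Σs : List (SC K)) → sumN (map Q Σs) ≡ unitTerms (concatMap upSet Σs)
sumN-map-Q []       = refl
sumN-map-Q (Σ ∷ Σs) =
  trans (cong₂ _++_ (sumN-M (upSet Σ)) (sumN-map-Q Σs)) (sym (unitTerms-++ (upSet Σ) (concatMap upSet Σs)))

coeff-∉ : ∀ κs {κ} → κ ∉ κs → coeff (map (1ℚ ,_) κs) κ ≡ 0ℚ
coeff-∉ []       _  = refl
coeff-∉ (κ′ ∷ κs) {κ} κ∉ with κ′ ≟K κ
... | yes refl = ⊥-elim (κ∉ (here refl))
... | no _     = trans (ℚP.+-identityˡ _) (coeff-∉ κs (κ∉ ∘ there))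

coeff-∈ : ∀ κs {κ} → Unique κs → κ ∈ κs → coeff (map (1ℚ ,_) κs) κ ≡ 1ℚ
coeff-∈ (κ′ ∷ κs) {κ} (κ′∉ ∷ κs!) κ∈ with κ′ ≟K κ | κ∈
... | yes refl | _          = cong (1ℚ +ℚ_) (coeff-∉ κs (λ κ′∈ → All.lookup κ′∉ κ′∈ refl))
... | no κ′≢κ  | here κ≡κ′  = ⊥-elim (κ′≢κ (sym κ≡κ′))
... | no _     | there κ∈′  = trans (ℚP.+-identityˡ _) (coeff-∈ κs κs! κ∈′)

unitTerms-≈ : ∀ {K} {Γs Δs : List (SC K)} → Unique Γs → Unique Δs → Γs ⊆ Δs → Δs ⊆ Γs → unitTerms Γs ≈ unitTerms Δs
unitTerms-≈ {K} {Γs} {Δs} Γs! Δs! Γs⊆Δs Δs⊆Γs κ with DecMembership._∈?_ _≟K_ κ (map (K ,_) Γs)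
... | yes κ∈ = trans (coeff-∈ _ (keys! Γs!) κ∈) (sym (coeff-∈ _ (keys! Δs!) (⊆P.map⁺ (K ,_) Γs⊆Δs κ∈)))
  where
  keys! : ∀ {Γs} → Unique Γs → Unique (map (K ,_) Γs)
  keys! = UniqueP.map⁺ λ { refl → refl }
... | no κ∉ = trans (coeff-∉ _ κ∉) (sym (coeff-∉ _ (κ∉ ∘ ⊆P.map⁺ (K ,_) Δs⊆Γs)))

module ShuffleProduct (n m : ℕ) where

  open Halves n m

  product? : ∀ (Φ′ : SC n) (Ψ′ : SC m) → Decidable (λ Γ → split n m ∧ Γ ≡ Φ′ ∣ Ψ′)
  product? Φ′ Ψ′ Γ = (split n m ∧ Γ) ≟SC (Φ′ ∣ Ψ′)

  productTerms : SC n → SC m → List (SC (n + m))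
  productTerms Φ′ Ψ′ = filter (product? Φ′ Ψ′) (allSC (n + m))

  upProducts : SC n → SC m → List (SC (n + m))
  upProducts Φ Ψ = concatMap (λ Φ′ → concatMap (productTerms Φ′) (upSet Ψ)) (upSet Φ)

  upShuffles : SC n → SC m → List (SC (n + m))
  upShuffles Φ Ψ = concatMap upSet (shuffleSC Φ Ψ)

  ∈productTerms⁻ : ∀ {Φ′ Ψ′ Γ} → Γ ∈ productTerms Φ′ Ψ′ → Γ ∈ allSC (n + m) × split n m ∧ Γ ≡ Φ′ ∣ Ψ′
  ∈productTerms⁻ {Φ′} {Ψ′} = ∈-filter⁻ (product? Φ′ Ψ′)

  shuffle-≤*⇒parts : ∀ {Φ Ψ S Γ} → All NonEmpty Φ → All NonEmpty Ψ → Interleaving (liftˡ Φ) (liftʳ Ψ) S → S ≤* Γ →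
                     (∃ λ Φ′ → leftPart Γ ≡ liftˡ Φ′ × Φ ≤* Φ′) ×
                     (∃ λ Ψ′ → rightPart Γ ≡ liftʳ Ψ′ × Ψ ≤* Ψ′)
  shuffle-≤*⇒parts {Φ} {Ψ} Φ≢[] Ψ≢[] sp c =
    ≤*-map⁻ (_↑ˡ m) ↑ˡ-reflect Φ (restrict-Interleaving isLeft? (liftˡ-blocks Φ≢[]) rightNotLeft sp) (≤*-restrict isLeft? c) ,
    ≤*-map⁻ (n ↑ʳ_) ↑ʳ-reflect Ψ (restrict-Interleaving isRight? (liftʳ-blocks Ψ≢[]) leftNotRight (Interleaving.swap sp))
            (≤*-restrict isRight? c)
    where
    rightNotLeft = All.map (All.map right⇒¬left) (liftʳ-right Ψ)
    leftNotRight = All.map (All.map left⇒¬right ∘ proj₂) (liftˡ-blocks Φ≢[])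

  shuffle-≤*⇒∈upProducts : ∀ {Φ Ψ S Γ} → IsSetComp n Φ → IsSetComp m Ψ →
                          Interleaving (liftˡ Φ) (liftʳ Ψ) S → S ≤* Γ → Γ ∈ upProducts Φ Ψ
  shuffle-≤*⇒∈upProducts {Γ = Γ} vΦ vΨ sp c with shuffle-≤*⇒parts (proj₁ vΦ) (proj₁ vΨ) sp c
  ... | (Φ′ , left≡ , cΦ) , (Ψ′ , right≡ , cΨ) =
    ∈-concatMap⁺′ _ (≤*⇒∈upSet cΦ) (∈-concatMap⁺′ _ (≤*⇒∈upSet cΨ)
      (∈-filter⁺ (product? Φ′ Ψ′) (IsSetComp⇒∈allSC Γ vΓ)
                 (trans (split-∧ (All.map (LinkedP.Linked⇒AllPairs FP.<-trans) (proj₁ (proj₂ vΓ)))) (cong₂ _++_ left≡ right≡))))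
    where
    vΓ = shuffle-≤*-IsSetComp vΦ vΨ sp c

  ∈upShuffles⇒∈upProducts : ∀ {Φ Ψ Γ} → IsSetComp n Φ → IsSetComp m Ψ → Γ ∈ upShuffles Φ Ψ → Γ ∈ upProducts Φ Ψ
  ∈upShuffles⇒∈upProducts {Φ} {Ψ} vΦ vΨ Γ∈ =
    let S , S∈ , Γ∈upS = ∈-concatMap⁻′ upSet (shuffleSC Φ Ψ) Γ∈ in
    shuffle-≤*⇒∈upProducts vΦ vΨ (∈shuffles⇒Interleaving (liftˡ Φ) (liftʳ Ψ) S∈) (∈upSet⇒≤* Γ∈upS)

  ∈upProducts⇒∈upShuffles : ∀ {Φ Ψ Γ} → All NonEmpty Φ → Γ ∈ upProducts Φ Ψ → Γ ∈ upShuffles Φ Ψ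
  ∈upProducts⇒∈upShuffles {Φ} {Ψ} Φ≢[] Γ∈ =
    let Φ′ , Φ′∈ , Γ∈′ = ∈-concatMap⁻′ _ (upSet Φ) Γ∈
        Ψ′ , Ψ′∈ , Γ∈″ = ∈-concatMap⁻′ _ (upSet Ψ) Γ∈′
        Γ∈allSC , ∧≡   = ∈productTerms⁻ {Φ′} {Ψ′} Γ∈″
        Γ≢[] , Γ-sorted = ∈allSC⇒blocks Γ∈allSC
        left≡ , right≡ = parts≡lifts Γ-sorted (≤*-nonEmpty Φ≢[] (∈upSet⇒≤* Φ′∈)) ∧≡
        S , sp , c     = parts⇒shuffle-≤* Γ≢[] Γ-sorted left≡ right≡ (∈upSet⇒≤* Φ′∈) (∈upSet⇒≤* Ψ′∈)
    in ∈-concatMap⁺′ upSet (Interleaving⇒∈shuffles sp) (≤*⇒∈upSet c)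

  Unique-upProducts : ∀ {Φ Ψ} → All NonEmpty Φ → Unique (upProducts Φ Ψ)
  Unique-upProducts {Φ} {Ψ} Φ≢[] =
    Unique-concatMap⁺ _ (Unique-upSet Φ)
      (λ {Φ′} Φ′∈ → Unique-concatMap⁺ _ (Unique-upSet Ψ)
                      (λ {Ψ′} _ → UniqueP.filter⁺ (product? Φ′ Ψ′) Unique-allSC)
                      (λ _ _ Γ∈₁ Γ∈₂ → proj₂ (same-factors Φ′∈ Φ′∈ Γ∈₁ Γ∈₂)))
      separated
    where
    same-factors : ∀ {Φ₁ Φ₂ Ψ₁ Ψ₂ Γ} → Φ₁ ∈ upSet Φ → Φ₂ ∈ upSet Φ →
                   Γ ∈ productTerms Φ₁ Ψ₁ → Γ ∈ productTerms Φ₂ Ψ₂ → Φ₁ ≡ Φ₂ × Ψ₁ ≡ Ψ₂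
    same-factors {Φ₁} {Φ₂} {Ψ₁} {Ψ₂} Φ₁∈ Φ₂∈ Γ∈₁ Γ∈₂ =
      ∣-injective (≤*-nonEmpty Φ≢[] (∈upSet⇒≤* Φ₁∈)) (≤*-nonEmpty Φ≢[] (∈upSet⇒≤* Φ₂∈))
                  (trans (sym (proj₂ (∈productTerms⁻ {Φ₁} {Ψ₁} Γ∈₁))) (proj₂ (∈productTerms⁻ {Φ₂} {Ψ₂} Γ∈₂)))
    separated : ∀ {Φ₁ Φ₂ Γ} → Φ₁ ∈ upSet Φ → Φ₂ ∈ upSet Φ →
                Γ ∈ concatMap (productTerms Φ₁) (upSet Ψ) → Γ ∈ concatMap (productTerms Φ₂) (upSet Ψ) → Φ₁ ≡ Φ₂
    separated {Φ₁} {Φ₂} Φ₁∈ Φ₂∈ Γ∈₁ Γ∈₂ =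
      let _ , _ , Γ∈₁′ = ∈-concatMap⁻′ (productTerms Φ₁) (upSet Ψ) Γ∈₁
          _ , _ , Γ∈₂′ = ∈-concatMap⁻′ (productTerms Φ₂) (upSet Ψ) Γ∈₂
      in proj₁ (same-factors Φ₁∈ Φ₂∈ Γ∈₁′ Γ∈₂′)

  Unique-upShuffles : ∀ {Φ Ψ} → All NonEmpty Φ → All NonEmpty Ψ → Unique (upShuffles Φ Ψ)
  Unique-upShuffles {Φ} {Ψ} Φ≢[] Ψ≢[] =
    Unique-concatMap⁺ upSet (Unique-shuffles (liftˡ Φ) (liftʳ Ψ) left≢right) (λ {S} _ → Unique-upSet S)
      λ S₁∈ S₂∈ Γ∈₁ Γ∈₂ →
        concat-Interleaving-injective (liftˡ-blocks Φ≢[]) rightBlocks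
          (∈shuffles⇒Interleaving _ _ S₁∈) (∈shuffles⇒Interleaving _ _ S₂∈)
          (trans (≤*-concat (∈upSet⇒≤* Γ∈₁)) (sym (≤*-concat (∈upSet⇒≤* Γ∈₂))))
    where
    rightBlocks = All.map (λ (B≢[] , rB) → B≢[] , All.map right⇒¬left rB) (liftʳ-blocks Ψ≢[])
    left≢right : ∀ {B C} → B ∈ liftˡ Φ → C ∈ liftʳ Ψ → B ≢ C
    left≢right B∈ C∈ refl =
      right⇒¬anyLeft (All.lookup (liftʳ-right Ψ) C∈) (All.lookup (anyLeft-liftˡ Φ≢[]) B∈)

  unitTerms-· : ∀ (Φs : List (SC n)) (Ψs : List (SC m)) →
                unitTerms Φs · unitTerms Ψs ≡ unitTerms (concatMap (λ Φ′ → concatMap (productTerms Φ′) Ψs) Φs)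
  unitTerms-· []       Ψs = refl
  unitTerms-· (Φ′ ∷ Φs) Ψs =
    trans (cong₂ _++_ (row Ψs) (unitTerms-· Φs Ψs))
          (sym (unitTerms-++ (concatMap (productTerms Φ′) Ψs) (concatMap (λ Φ″ → concatMap (productTerms Φ″) Ψs) Φs)))
    where
    row : ∀ Ψs → concatMap (λ (b , κ) → scale (1ℚ *ℚ b) (MMkey (n , Φ′) κ)) (unitTerms Ψs)
                 ≡ unitTerms (concatMap (productTerms Φ′) Ψs)
    row []        = refl
    row (Ψ′ ∷ Ψs) = trans (cong₂ _++_ (scale-sumN-M (productTerms Φ′ Ψ′)) (row Ψs))
                          (sym (unitTerms-++ (productTerms Φ′ Ψ′) (concatMap (productTerms Φ′) Ψs)))

mainTheorem12 : (n m : ℕ) (Φ : SC n) (Ψ : SC m) → IsSetComp n Φ → IsSetComp m Ψ →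
                  (Q Φ · Q Ψ) ≈ sumN (map Q (shuffleSC Φ Ψ))
mainTheorem12 n m Φ Ψ vΦ vΨ κ = begin
  coeff (Q Φ · Q Ψ) κ
    ≡⟨ cong (λ x → coeff x κ) (cong₂ _·_ (sumN-M (upSet Φ)) (sumN-M (upSet Ψ))) ⟩
  coeff (unitTerms (upSet Φ) · unitTerms (upSet Ψ)) κ
    ≡⟨ cong (λ x → coeff x κ) (unitTerms-· (upSet Φ) (upSet Ψ)) ⟩
  coeff (unitTerms (upProducts Φ Ψ)) κ
    ≡⟨ unitTerms-≈ (Unique-upProducts {Φ} {Ψ} (proj₁ vΦ)) (Unique-upShuffles (proj₁ vΦ) (proj₁ vΨ))
                   (∈upProducts⇒∈upShuffles {Φ} {Ψ} (proj₁ vΦ)) (∈upShuffles⇒∈upProducts vΦ vΨ) κ ⟩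
  coeff (unitTerms (upShuffles Φ Ψ)) κ
    ≡⟨ cong (λ x → coeff x κ) (sumN-map-Q (shuffleSC Φ Ψ)) ⟨
  coeff (sumN (map Q (shuffleSC Φ Ψ))) κ ∎
  where
  open ≡-Reasoning
  open ShuffleProduct n m
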